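{- Let $(a,b)\in\mathbb F_q^2$ and let $\lambda\in\mathbb F_q^*$ be such that $1+\lambda^2$ is a nonzero square in $\mathbb F_q$. Let $L_\lambda(a,b)=\{(x_1+a,x_2+b)\in\mathbb F_q^2: x_2=\lambda x_1\}$. If $A\subseteq\mathbb F_q^2$ and $B\subseteq L_\lambda(a,b)$ satisfy $|A||B|\ge 2q^2$, then $|\Delta(A,B)|\ge q/2$.
   Context: $q$ is a power of an odd prime and $\mathbb F_q$ is the field with $q$ elements. For $x=(x_1,x_2)\in\mathbb F_q^2$, $\|x\|=x_1^2+x_2^2$, and for $A,B\subseteq\mathbb F_q^2$, $\Delta(A,B)=\{\|x-y\|: x\in A,\ y\in B\}$. -}

module Defs where

open import Data.Nat using (ℕ; zero; suc; _*_; _^_; _≤_)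
open import Data.Nat.Primality using (Prime)
open import Data.Fin using (Fin)
open import Data.Fin.Properties using () renaming (_≟_ to _≟F_)
open import Data.Bool using (Bool; true; false; _∧_)
open import Data.List using (List; map; filter; length)
open import Data.Bool.ListAction using (any)
open import Data.List.Base using (cartesianProduct)
open import Data.Product using (Σ; ∃; _×_; _,_; proj₁; proj₂)
open import Function.Bundles using (_↔_; Inverse)
open import Relation.Binary.PropositionalEquality using (_≡_; _≢_; cong)
open import Relation.Nullary using (Dec; yes; no; does)
open import Relation.Nullary.Decidable using (map′)
open import Algebra.Structures using (IsCommutativeRing)
open import Data.List.Base using (allFin)

record FiniteField (q : ℕ) : Set₁ where
  infixl 6 _+_ _-_
  infixl 7 _·_
  field
    Carrier : Set
    _+_ _·_ : Carrier → Carrier → Carrier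
    -_      : Carrier → Carrier
    0# 1#   : Carrier
    isCommutativeRing : IsCommutativeRing _≡_ _+_ _·_ -_ 0# 1#
    0≢1     : 0# ≢ 1#
    inverse : ∀ x → x ≢ 0# → ∃ λ y → x · y ≡ 1#
    enum    : Carrier ↔ Fin q

  _-_ : Carrier → Carrier → Carrier
  x - y = x + (- y)

  _≟_ : (x y : Carrier) → Dec (x ≡ y)
  x ≟ y = map′ (λ e → to-inj e) (cong (Inverse.to enum)) (Inverse.to enum x ≟F Inverse.to enum y)
    where
    to-inj : Inverse.to enum x ≡ Inverse.to enum y → x ≡ y
    to-inj e = Relation.Binary.PropositionalEquality.trans
                 (Relation.Binary.PropositionalEquality.sym (Inverse.inverseʳ enum Relation.Binary.PropositionalEquality.refl))
                 (Relation.Binary.PropositionalEquality.trans (cong (Inverse.from enum) e)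
                   (Inverse.inverseʳ enum Relation.Binary.PropositionalEquality.refl))

  elements : List Carrier
  elements = map (Inverse.from enum) (allFin q)

  Point : Set
  Point = Carrier × Carrier

  points : List Point
  points = cartesianProduct elements elements

  ‖_‖ : Point → Carrier
  ‖ (x₁ , x₂) ‖ = x₁ · x₁ + x₂ · x₂

  _-ᵖ_ : Point → Point → Point
  (x₁ , x₂) -ᵖ (y₁ , y₂) = (x₁ - y₁ , x₂ - y₂)

  Subset² : Set
  Subset² = Point → Bool

  _∈ᵇ_ : Point → Subset² → Set
  x ∈ᵇ A = A x ≡ true

  card² : Subset² → ℕ
  card² A = length (filter (λ x → A x Data.Bool.≟ true) points)

  Δ : Subset² → Subset² → Carrier → Bool
  Δ A B t = any (λ x → any (λ y → A x ∧ B y ∧ does (‖ x -ᵖ y ‖ ≟ t)) points) points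

  cardΔ : Subset² → Subset² → ℕ
  cardΔ A B = length (filter (λ t → Δ A B t Data.Bool.≟ true) elements)

  _∈L[_,_,_] : Point → Carrier → Carrier → Carrier → Set
  p ∈L[ λ' , a , b ] = Σ Carrier λ x₁ → Σ Carrier λ x₂ → (x₂ ≡ λ' · x₁) × (p ≡ (x₁ + a , x₂ + b))

  IsSquare : Carrier → Set
  IsSquare c = Σ Carrier λ s → s · s ≡ c

OddPrimePower : ℕ → Set
OddPrimePower q = Σ ℕ λ p → Σ ℕ λ k → Prime p × (p ≢ 2) × (q ≡ p ^ k)

{-# OPTIONS --safe #-}
module Submission where

-- Parametrise B by s ↦ (s + a , λ s + b). For every x ∈ 𝔽q², expanding the norm gives
--   ‖x − (s + a , λ s + b)‖ = c₀ + μ s² − 2 u s,   μ = 1 + λ²,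
-- where c = (c₀ , u) = (‖x − (a , b)‖ , (x₁ − a) + λ (x₂ − b)) depends on x only. Let hits(c)
-- count the points of B at which this quadratic takes a value in Δ = Δ(A , B), and write
-- m = |B|, k = |Δ|. Every x ∈ A has hits(c) = m, and since μ ≠ 0 at most two points x share
-- the same c, so |A| ≤ 2 n with n = #{c : hits(c) = m}. As c ranges over 𝔽q², the value of the
-- quadratic at one s is uniformly distributed, and (because 2 ≠ 0, q being odd) its values at
-- two distinct s are independent and uniform; hence
--   Σ hits = m q k   and   Σ hits² = m q k + m (m − 1) k².
-- Chebyshev's inequality around the mean m k / q then gives n m (q − k) ≤ q² k, and if
-- 2 k < q this forces |A| m ≤ 2 n m < 2 q².

open import Defs
open import Algebra.Bundles using (CommutativeRing)
open import Data.Bool as Bool using (Bool; true; false; T; not; _∧_)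
open import Data.Bool.Properties using (T-∧; T-≡)
open import Data.Empty using (⊥-elim)
open import Data.Fin as Fin using (Fin)
import Data.Fin.Properties as Fin
import Data.Integer as ℤ
open import Data.List as List using ([]; _∷_; length; filter)
import Data.List.Properties as List
open import Data.Nat as ℕ using (ℕ; zero; suc; _*_; _∸_; _^_; _/_; _%_; _≤_; _<_; z≤n; s≤s)
import Data.Nat.ListAction as ℕ using (sum)
import Data.Nat.ListAction.Properties as ℕ using (sum-++)
import Data.Nat.Properties as ℕ
open import Data.Product using (_,_; proj₁; proj₂)
open import Function using (_∘_; id; _↔_; Inverse; mk↔ₛ′; Equivalence)
open import Relation.Binary.PropositionalEquality
  using (_≡_; _≢_; refl; sym; trans; cong; cong₂; subst; subst₂; module ≡-Reasoning)
open import Relation.Nullary using (Dec; yes; no; does; ¬_)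
open import Relation.Nullary.Decidable using (⌊_⌋; T?; toWitness; fromWitness)

module Counting where
  open import Data.Nat using (_+_)
  open import Data.Product using (_×_; uncurry; map)
  open import Data.Product.Function.NonDependent.Propositional using (_×-↔_)
  open import Data.Fin using (combine; remQuot; _↑ˡ_; _↑ʳ_)
  open import Data.Fin.Permutation using (Permutation)
  open import Data.Vec.Functional using (Vector)
  open import Function.Construct.Composition using (_↔-∘_)
  open import Function.Construct.Symmetry using (↔-sym)
  open import Function.Properties.Inverse using (↔⇒↣)
  open import Relation.Nullary.Decidable using (via-injection)
  import Algebra.Properties.Semiring.Sum ℕ.+-*-semiring as Sum
  open Sum using (sum; sum-cong-≗)

  𝟙 : Bool → ℕ
  𝟙 true  = 1
  𝟙 false = 0

  𝟙-∧ : ∀ b c → 𝟙 (b ∧ c) ≡ 𝟙 b * 𝟙 c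
  𝟙-∧ true  c = sym (ℕ.+-identityʳ (𝟙 c))
  𝟙-∧ false c = refl

  𝟙≤1 : ∀ b → 𝟙 b ≤ 1
  𝟙≤1 true  = ℕ.≤-refl
  𝟙≤1 false = z≤n

  𝟙-T : ∀ {b} → T b → 𝟙 b ≡ 1
  𝟙-T {true} _ = refl

  𝟙-¬T : ∀ {b} → ¬ T b → 𝟙 b ≡ 0
  𝟙-¬T {true}  ¬b = ⊥-elim (¬b _)
  𝟙-¬T {false} _  = refl

  𝟙-mono : ∀ {b c} → (T b → T c) → 𝟙 b ≤ 𝟙 c
  𝟙-mono {false} b⇒c = z≤n
  𝟙-mono {true}  b⇒c = ℕ.≤-reflexive (sym (𝟙-T (b⇒c _)))

  𝟙*𝟙≡𝟙 : ∀ {b c} → (T b → T c) → 𝟙 b * 𝟙 c ≡ 𝟙 b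
  𝟙*𝟙≡𝟙 {false} b⇒c = refl
  𝟙*𝟙≡𝟙 {true}  b⇒c = cong (_+ 0) (𝟙-T (b⇒c _))

  sum-tabulate : ∀ {n} (g : Fin n → ℕ) → ℕ.sum (List.tabulate g) ≡ sum g
  sum-tabulate {zero}  g = refl
  sum-tabulate {suc n} g = cong (g Fin.zero +_) (sum-tabulate (g ∘ Fin.suc))

  length-filter≡sum : ∀ {A : Set} (p : A → Bool) xs →
    length (filter (λ x → p x Bool.≟ true) xs) ≡ ℕ.sum (List.map (𝟙 ∘ p) xs)
  length-filter≡sum p []       = refl
  length-filter≡sum p (x ∷ xs) with p x
  ... | true  = cong suc (length-filter≡sum p xs)
  ... | false = length-filter≡sum p xs

  sum-cartesianProduct : ∀ {A B : Set} (f : A × B → ℕ) xs ys →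
    ℕ.sum (List.map f (List.cartesianProduct xs ys)) ≡
    ℕ.sum (List.map (λ x → ℕ.sum (List.map (λ y → f (x , y)) ys)) xs)
  sum-cartesianProduct f []       ys = refl
  sum-cartesianProduct {A} {B} f (x ∷ xs) ys = begin
    ℕ.sum (List.map f (row List.++ rest))                          ≡⟨ cong ℕ.sum (List.map-++ f row rest) ⟩
    ℕ.sum (List.map f row List.++ List.map f rest)                 ≡⟨ ℕ.sum-++ (List.map f row) (List.map f rest) ⟩
    ℕ.sum (List.map f row) + ℕ.sum (List.map f rest)               ≡⟨ cong₂ _+_ (cong ℕ.sum (sym (List.map-∘ ys)))
                                                                                (sum-cartesianProduct f xs ys) ⟩
    ℕ.sum (List.map (λ y → f (x , y)) ys)
      + ℕ.sum (List.map (λ x → ℕ.sum (List.map (λ y → f (x , y)) ys)) xs) ∎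
    where
    open ≡-Reasoning
    row rest : List.List (A × B)
    row = List.map (x ,_) ys
    rest = List.cartesianProduct xs ys

  private
    sum-mono-≤ : ∀ {n} {f g : Vector ℕ n} → (∀ i → f i ≤ g i) → sum f ≤ sum g
    sum-mono-≤ {zero}  f≤g = z≤n
    sum-mono-≤ {suc n} f≤g = ℕ.+-mono-≤ (f≤g Fin.zero) (sum-mono-≤ (f≤g ∘ Fin.suc))

    sum-const : ∀ n c → sum {n} (λ _ → c) ≡ n * c
    sum-const zero    c = refl
    sum-const (suc n) c = cong (c +_) (sum-const n c)

    sum-single : ∀ {n} (g : Vector ℕ n) i → (∀ j → j ≢ i → g j ≡ 0) → sum g ≡ g i
    sum-single {suc n} g i g≡0 = begin
      sum g                              ≡⟨ Sum.sum-remove g ⟩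
      g i + sum (g ∘ Fin.punchIn i)      ≡⟨ cong (g i +_) (sum-cong-≗ (λ j → g≡0 _ (Fin.punchInᵢ≢i i j))) ⟩
      g i + sum {n} (λ _ → 0)            ≡⟨ cong (g i +_) (Sum.sum-replicate-zero n) ⟩
      g i + 0                            ≡⟨ ℕ.+-identityʳ (g i) ⟩
      g i                                ∎
      where open ≡-Reasoning

    sum-↑ : ∀ m {n} (g : Vector ℕ (m + n)) → sum g ≡ sum (g ∘ (_↑ˡ n)) + sum (g ∘ (m ↑ʳ_))
    sum-↑ zero        g = refl
    sum-↑ (suc m) {n} g =
      trans (cong (g Fin.zero +_) (sum-↑ m {n} (g ∘ Fin.suc))) (sym (ℕ.+-assoc (g Fin.zero) _ _))

    sum-combine : ∀ m {n} (g : Vector ℕ (m * n)) → sum g ≡ sum {m} (λ i → sum {n} (λ j → g (combine i j)))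
    sum-combine zero        g = refl
    sum-combine (suc m) {n} g =
      trans (sum-↑ n g) (cong (sum {n} (λ j → g (j ↑ˡ m * n)) +_) (sum-combine m {n} (g ∘ (n ↑ʳ_))))

    ×↔* : ∀ {m n} → (Fin m × Fin n) ↔ Fin (m * n)
    ×↔* {m} {n} =
      mk↔ₛ′ (uncurry combine) (remQuot n) (Fin.combine-remQuot {m} n) (λ (i , j) → Fin.remQuot-combine i j)

  record Finite (A : Set) : Set where
    field
      size        : ℕ
      enumeration : A ↔ Fin size

    index : A → Fin size
    index = Inverse.to enumeration

    element : Fin size → A
    element = Inverse.from enumeration

    element-index : ∀ x → element (index x) ≡ x
    element-index x = Inverse.strictlyInverseʳ enumeration x

    index-element : ∀ i → index (element i) ≡ i
    index-element i = Inverse.strictlyInverseˡ enumeration i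

  instance
    ×-finite : ∀ {A B} → {{Finite A}} → {{Finite B}} → Finite (A × B)
    ×-finite {{finiteA}} {{finiteB}} = record
      { size        = Finite.size finiteA * Finite.size finiteB
      ; enumeration = ×↔* ↔-∘ (Finite.enumeration finiteA ×-↔ Finite.enumeration finiteB)
      }

  module _ {A : Set} {{finite : Finite A}} where
    open Finite finite

    ∑ : (A → ℕ) → ℕ
    ∑ f = sum (f ∘ element)

    count : (A → Bool) → ℕ
    count p = ∑ (𝟙 ∘ p)

    -- Opaque, so that `with x ≟ₑ y` also abstracts the Booleans `does (x ≟ₑ y)` in the goal.
    opaque
      _≟ₑ_ : (x y : A) → Dec (x ≡ y)
      _≟ₑ_ = via-injection (↔⇒↣ enumeration) Fin._≟_

    _≢ᵇ_ : A → A → Bool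
    x ≢ᵇ y = not (does (x ≟ₑ y))

    ∑-cong : ∀ {f g : A → ℕ} → (∀ x → f x ≡ g x) → ∑ f ≡ ∑ g
    ∑-cong f≗g = sum-cong-≗ (f≗g ∘ element)

    ∑-mono-≤ : ∀ {f g : A → ℕ} → (∀ x → f x ≤ g x) → ∑ f ≤ ∑ g
    ∑-mono-≤ f≤g = sum-mono-≤ (f≤g ∘ element)

    ∑-distrib-+ : ∀ (f g : A → ℕ) → ∑ (λ x → f x + g x) ≡ ∑ f + ∑ g
    ∑-distrib-+ f g = Sum.∑-distrib-+ (f ∘ element) (g ∘ element)

    ∑-*ˡ : ∀ c (f : A → ℕ) → ∑ (λ x → c * f x) ≡ c * ∑ f
    ∑-*ˡ c f = sym (Sum.*-distribˡ-sum c (f ∘ element))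

    ∑-*ʳ : ∀ c (f : A → ℕ) → ∑ (λ x → f x * c) ≡ ∑ f * c
    ∑-*ʳ c f = sym (Sum.*-distribʳ-sum c (f ∘ element))

    ∑-const : ∀ c → ∑ (λ _ → c) ≡ size * c
    ∑-const c = sum-const size c

    ∑-zero : ∀ {f : A → ℕ} → (∀ x → f x ≡ 0) → ∑ f ≡ 0
    ∑-zero f≡0 = trans (∑-cong f≡0) (trans (∑-const 0) (ℕ.*-zeroʳ size))

    ∑-square : ∀ (f : A → ℕ) → ∑ f * ∑ f ≡ ∑ (λ x → ∑ (λ y → f x * f y))
    ∑-square f = trans (sym (∑-*ʳ (∑ f) f)) (∑-cong (λ x → sym (∑-*ˡ (f x) f)))

    ∑-single : ∀ (f : A → ℕ) y → (∀ x → x ≢ y → f x ≡ 0) → ∑ f ≡ f y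
    ∑-single f y f≡0 = trans (sum-single (f ∘ element) (index y) off-y) (cong f (element-index y))
      where
      off-y : ∀ i → i ≢ index y → f (element i) ≡ 0
      off-y i i≢ = f≡0 (element i) (λ e → i≢ (trans (sym (index-element i)) (cong index e)))

    induced-permutation : A ↔ A → Permutation size size
    induced-permutation σ = enumeration ↔-∘ (σ ↔-∘ ↔-sym enumeration)

    ∑-reindex : ∀ (σ : A ↔ A) (f : A → ℕ) → ∑ (f ∘ Inverse.to σ) ≡ ∑ f
    ∑-reindex σ f = sym (trans (Sum.∑-permute (f ∘ element) (induced-permutation σ))
                               (sum-cong-≗ (cong f ∘ element-index ∘ Inverse.to σ ∘ element)))

    ∑-remove : ∀ (f : A → ℕ) y → ∑ f ≡ f y + ∑ (λ x → 𝟙 (x ≢ᵇ y) * f x)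
    ∑-remove f y = begin
      ∑ f                          ≡⟨ ∑-cong split ⟩
      ∑ (λ x → at-y x + off-y x)   ≡⟨ ∑-distrib-+ at-y off-y ⟩
      ∑ at-y + ∑ off-y             ≡⟨ cong (_+ ∑ off-y) (trans (∑-single at-y y vanishes) at-y≡f) ⟩
      f y + ∑ off-y                ∎
      where
      open ≡-Reasoning
      off-y : A → ℕ
      off-y x = 𝟙 (x ≢ᵇ y) * f x
      at-y : A → ℕ
      at-y x = 𝟙 (does (x ≟ₑ y)) * f x
      split : ∀ x → f x ≡ at-y x + off-y x
      split x with x ≟ₑ y
      ... | yes _ = sym (trans (ℕ.+-identityʳ _) (ℕ.+-identityʳ (f x)))
      ... | no  _ = sym (ℕ.+-identityʳ (f x))
      vanishes : ∀ x → x ≢ y → at-y x ≡ 0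
      vanishes x x≢y with x ≟ₑ y
      ... | yes x≡y = ⊥-elim (x≢y x≡y)
      ... | no  _   = refl
      at-y≡f : at-y y ≡ f y
      at-y≡f with y ≟ₑ y
      ... | yes _   = ℕ.+-identityʳ (f y)
      ... | no  y≢y = ⊥-elim (y≢y refl)

    count-remove : ∀ (p : A → Bool) y → count p ≡ 𝟙 (p y) + count (λ x → x ≢ᵇ y ∧ p x)
    count-remove p y =
      trans (∑-remove (𝟙 ∘ p) y) (cong (𝟙 (p y) +_) (∑-cong (λ x → sym (𝟙-∧ (x ≢ᵇ y) (p x)))))

    count-none : ∀ {p : A → Bool} → (∀ x → ¬ T (p x)) → count p ≡ 0
    count-none none = ∑-zero (𝟙-¬T ∘ none)

    T-removed : ∀ {p : A → Bool} {x y} → T (x ≢ᵇ y ∧ p x) → x ≢ y × T (p x)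
    T-removed {x = x} {y} h with x ≟ₑ y
    ... | yes _   = ⊥-elim h
    ... | no  x≢y = x≢y , h

    count≤suc : ∀ {k} (p : A → Bool) → (∀ y → T (p y) → count (λ x → x ≢ᵇ y ∧ p x) ≤ k) → count p ≤ suc k
    count≤suc p bound with Fin.any? (λ i → T? (p (element i)))
    ... | yes (i , pi) = begin
      count p                                                  ≡⟨ count-remove p (element i) ⟩
      𝟙 (p (element i)) + count (λ x → x ≢ᵇ element i ∧ p x)   ≤⟨ ℕ.+-mono-≤ (𝟙≤1 _) (bound (element i) pi) ⟩
      suc _                                                    ∎
      where open ℕ.≤-Reasoning
    ... | no none = ℕ.≤-trans (ℕ.≤-reflexive (count-none absent)) z≤n
      where
      absent : ∀ x → ¬ T (p x)
      absent x px = none (index x , subst (T ∘ p) (sym (element-index x)) px)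

    count≤1 : ∀ (p : A → Bool) → (∀ {x y} → T (p x) → T (p y) → x ≡ y) → count p ≤ 1
    count≤1 p unique = count≤suc p (λ y py → ℕ.≤-reflexive (count-none {λ x → x ≢ᵇ y ∧ p x} (λ x h →
      let (x≢y , px) = T-removed {p} h in x≢y (unique px py))))

    count≤2 : ∀ (p : A → Bool) → (∀ {x y z} → T (p x) → T (p y) → T (p z) → x ≢ y → x ≢ z → y ≡ z) →
      count p ≤ 2
    count≤2 p no-three = count≤suc p (λ x px → count≤1 (λ y → y ≢ᵇ x ∧ p y) (λ hy hz →
      let (y≢x , py) = T-removed {p} hy
          (z≢x , pz) = T-removed {p} hz
      in no-three px py pz (y≢x ∘ sym) (z≢x ∘ sym)))

    ∑-row : ∀ (t : A → Bool) (w : A → ℕ) {x} D O → T (t x) → w x ≡ D → (∀ y → y ≢ x → w y ≡ O) →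
      ∑ (λ y → 𝟙 (t y) * w y) + O ≡ D + count t * O
    ∑-row t w {x} D O tx wx≡D off-x = begin
      ∑ (λ y → 𝟙 (t y) * w y) + O
        ≡⟨ cong (_+ O) (∑-remove (λ y → 𝟙 (t y) * w y) x) ⟩
      𝟙 (t x) * w x + ∑ (λ y → 𝟙 (y ≢ᵇ x) * (𝟙 (t y) * w y)) + O
        ≡⟨ cong₂ (λ d r → d + r + O) at-x (trans (∑-cong off) (∑-*ʳ O (𝟙 ∘ t∖x))) ⟩
      D + count t∖x * O + O     ≡⟨ ℕ.+-assoc D _ O ⟩
      D + (count t∖x * O + O)   ≡⟨ cong (D +_) (ℕ.+-comm _ O) ⟩
      D + suc (count t∖x) * O   ≡⟨ cong (λ c → D + c * O) count-t ⟨
      D + count t * O           ∎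
      where
      open ≡-Reasoning
      t∖x : A → Bool
      t∖x y = y ≢ᵇ x ∧ t y
      at-x : 𝟙 (t x) * w x ≡ D
      at-x = trans (cong (_* w x) (𝟙-T tx)) (trans (ℕ.*-identityˡ (w x)) wx≡D)
      count-t : count t ≡ suc (count t∖x)
      count-t = trans (count-remove t x) (cong (_+ count t∖x) (𝟙-T tx))
      off : ∀ y → 𝟙 (y ≢ᵇ x) * (𝟙 (t y) * w y) ≡ 𝟙 (t∖x y) * O
      off y with y ≟ₑ x
      ... | yes _   = refl
      ... | no  y≢x = trans (ℕ.*-identityˡ _) (cong (𝟙 (t y) *_) (off-x y y≢x))

    ∑-pairs : ∀ (t : A → Bool) (W : A → A → ℕ) D O → (∀ x → W x x ≡ D) → (∀ x y → x ≢ y → W x y ≡ O) →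
      ∑ (λ x → 𝟙 (t x) * ∑ (λ y → 𝟙 (t y) * W x y)) + count t * O ≡ count t * (D + count t * O)
    ∑-pairs t W D O diagonal off-diagonal = begin
      ∑ (λ x → 𝟙 (t x) * row x) + count t * O
        ≡⟨ cong (∑ (λ x → 𝟙 (t x) * row x) +_) (∑-*ʳ O (𝟙 ∘ t)) ⟨
      ∑ (λ x → 𝟙 (t x) * row x) + ∑ (λ x → 𝟙 (t x) * O)
        ≡⟨ ∑-distrib-+ (λ x → 𝟙 (t x) * row x) (λ x → 𝟙 (t x) * O) ⟨
      ∑ (λ x → 𝟙 (t x) * row x + 𝟙 (t x) * O)
        ≡⟨ ∑-cong (λ x → ℕ.*-distribˡ-+ (𝟙 (t x)) (row x) O) ⟨
      ∑ (λ x → 𝟙 (t x) * (row x + O))             ≡⟨ ∑-cong per-row ⟩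
      ∑ (λ x → 𝟙 (t x) * (D + count t * O))       ≡⟨ ∑-*ʳ (D + count t * O) (𝟙 ∘ t) ⟩
      count t * (D + count t * O)                 ∎
      where
      open ≡-Reasoning
      row : A → ℕ
      row x = ∑ (λ y → 𝟙 (t y) * W x y)
      per-row : ∀ x → 𝟙 (t x) * (row x + O) ≡ 𝟙 (t x) * (D + count t * O)
      per-row x with T? (t x)
      ... | yes tx = cong (𝟙 (t x) *_) (∑-row t (W x) D O tx (diagonal x) (λ y y≢x → off-diagonal x y (y≢x ∘ sym)))
      ... | no ¬tx = trans (cong (_* (row x + O)) (𝟙-¬T ¬tx)) (sym (cong (_* (D + count t * O)) (𝟙-¬T ¬tx)))

  module _ {A B : Set} {{finiteA : Finite A}} {{finiteB : Finite B}} where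
    private
      module A = Finite finiteA
      module B = Finite finiteB

    ∑-comm : ∀ (h : A → B → ℕ) → ∑ (λ x → ∑ (h x)) ≡ ∑ (λ y → ∑ (λ x → h x y))
    ∑-comm h = Sum.∑-comm (λ i j → h (A.element i) (B.element j))

    ∑-× : ∀ (f : A × B → ℕ) → ∑ f ≡ ∑ (λ x → ∑ (λ y → f (x , y)))
    ∑-× f = trans (sum-combine A.size (f ∘ Finite.element (×-finite {A} {B})))
      (sum-cong-≗ (λ i → sum-cong-≗ (λ j → cong (f ∘ map A.element B.element) (Fin.remQuot-combine i j))))

  module _ {A C : Set} {{_ : Finite A}} {{_ : Finite C}} where

    count≤bounded-fibres : ∀ (φ : A → C) (S : A → Bool) (G : C → Bool) r →
      (∀ {x} → T (S x) → T (G (φ x))) → (∀ c → count (λ x → ⌊ φ x ≟ₑ c ⌋) ≤ r) → count S ≤ r * count G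
    count≤bounded-fibres φ S G r S⇒G fibre≤r = begin
      count S                                        ≡⟨ ∑-cong spread ⟩
      ∑ (λ x → ∑ (λ c → 𝟙 (S x) * 𝟙 ⌊ φ x ≟ₑ c ⌋))    ≡⟨ ∑-comm (λ x c → 𝟙 (S x) * 𝟙 ⌊ φ x ≟ₑ c ⌋) ⟩
      ∑ (λ c → ∑ (λ x → 𝟙 (S x) * 𝟙 ⌊ φ x ≟ₑ c ⌋))    ≤⟨ ∑-mono-≤ fibre ⟩
      ∑ (λ c → r * 𝟙 (G c))                         ≡⟨ ∑-*ˡ r (𝟙 ∘ G) ⟩
      r * count G                                    ∎
      where
      open ℕ.≤-Reasoning
      one-image : ∀ x → ∑ (λ c → 𝟙 ⌊ φ x ≟ₑ c ⌋) ≡ 1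
      one-image x = trans (∑-single (λ c → 𝟙 ⌊ φ x ≟ₑ c ⌋) (φ x) (λ c c≢φx → 𝟙-¬T (c≢φx ∘ sym ∘ toWitness)))
                          (𝟙-T (fromWitness {a? = φ x ≟ₑ φ x} refl))
      spread : ∀ x → 𝟙 (S x) ≡ ∑ (λ c → 𝟙 (S x) * 𝟙 ⌊ φ x ≟ₑ c ⌋)
      spread x = sym (trans (∑-*ˡ (𝟙 (S x)) (λ c → 𝟙 ⌊ φ x ≟ₑ c ⌋))
                            (trans (cong (𝟙 (S x) *_) (one-image x)) (ℕ.*-identityʳ (𝟙 (S x)))))
      fibre : ∀ c → ∑ (λ x → 𝟙 (S x) * 𝟙 ⌊ φ x ≟ₑ c ⌋) ≤ r * 𝟙 (G c)
      fibre c with T? (G c)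
      ... | yes Gc = begin
        ∑ (λ x → 𝟙 (S x) * 𝟙 ⌊ φ x ≟ₑ c ⌋)  ≤⟨ ∑-mono-≤ (λ x → ℕ.*-monoˡ-≤ (𝟙 ⌊ φ x ≟ₑ c ⌋) (𝟙≤1 (S x))) ⟩
        ∑ (λ x → 1 * 𝟙 ⌊ φ x ≟ₑ c ⌋)        ≡⟨ ∑-cong (λ x → ℕ.*-identityˡ (𝟙 ⌊ φ x ≟ₑ c ⌋)) ⟩
        count (λ x → ⌊ φ x ≟ₑ c ⌋)          ≤⟨ fibre≤r c ⟩
        r                                  ≡⟨ ℕ.*-identityʳ r ⟨
        r * 1                              ≡⟨ cong (r *_) (𝟙-T Gc) ⟨
        r * 𝟙 (G c)                         ∎
      ... | no ¬Gc = ℕ.≤-trans (ℕ.≤-reflexive (∑-zero outside)) z≤n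
        where
        outside : ∀ x → 𝟙 (S x) * 𝟙 ⌊ φ x ≟ₑ c ⌋ ≡ 0
        outside x = trans (sym (𝟙-∧ (S x) _)) (𝟙-¬T λ h →
          let (Sx , φx≡c) = Equivalence.to T-∧ h in ¬Gc (subst (T ∘ G) (toWitness φx≡c) (S⇒G Sx)))

open Counting

module SecondMoment where
  open import Data.Nat using (_+_; NonZero)
  open import Data.Nat.Tactic.RingSolver using (solve)
  open import Data.Sum using (inj₁; inj₂)

  a≤b⇒2ab≤a²+b² : ∀ {a b} → a ≤ b → 2 * (a * b) ≤ a * a + b * b
  a≤b⇒2ab≤a²+b² {a} {b} a≤b = subst (λ b → 2 * (a * b) ≤ a * a + b * b) (ℕ.m+[n∸m]≡n a≤b) (gap a (b ∸ a))
    where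
    gap : ∀ a d → 2 * (a * (a + d)) ≤ a * a + (a + d) * (a + d)
    gap a d = ℕ.≤-trans (ℕ.m≤m+n _ (d * d)) (ℕ.≤-reflexive (solve (a ∷ d ∷ [])))

  2ab≤a²+b² : ∀ a b → 2 * (a * b) ≤ a * a + b * b
  2ab≤a²+b² a b with ℕ.≤-total a b
  ... | inj₁ a≤b = a≤b⇒2ab≤a²+b² a≤b
  ... | inj₂ b≤a = subst₂ _≤_ (cong (2 *_) (ℕ.*-comm b a)) (ℕ.+-comm (b * b) (a * a)) (a≤b⇒2ab≤a²+b² b≤a)

  chebyshev-term : ∀ {q} k d m y → q ≡ k + d →
    2 * (q * (m * k)) * y + 𝟙 ⌊ y ℕ.≟ m ⌋ * (m * d * (m * d)) ≤ q * q * (y * y) + m * k * (m * k)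
  chebyshev-term k d m y refl with y ℕ.≟ m
  ... | yes refl = ℕ.≤-reflexive (solve (k ∷ d ∷ y ∷ []))
  ... | no  _    = begin
    2 * ((k + d) * (m * k)) * y + 0                ≡⟨ ℕ.+-identityʳ _ ⟩
    2 * ((k + d) * (m * k)) * y                    ≡⟨ solve (k ∷ d ∷ m ∷ y ∷ []) ⟩
    2 * ((k + d) * y * (m * k))                    ≤⟨ 2ab≤a²+b² ((k + d) * y) (m * k) ⟩
    (k + d) * y * ((k + d) * y) + m * k * (m * k)  ≡⟨ solve (k ∷ d ∷ m ∷ y ∷ []) ⟩
    (k + d) * (k + d) * (y * y) + m * k * (m * k)  ∎
    where open ℕ.≤-Reasoning

  second-moment-bound : ∀ {q k d m n S₁ S₂} → q ≡ k + d →
    S₁ ≡ m * (q * k) → S₂ + m * (k * k) ≡ m * (q * k + m * (k * k)) →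
    2 * (q * (m * k)) * S₁ + n * (m * d * (m * d)) ≤ q * q * S₂ + q * q * (m * k * (m * k)) →
    n * (m * d) ≤ q * q * k
  second-moment-bound {k = k} {d} {m} {n} {S₂ = S₂} refl refl S₂-eq bound =
    cancel-md (ℕ.+-cancelˡ-≤ (2 * ((k + d) * (m * k)) * ((k + d) * (m * k))) _ _ (begin
      2 * ((k + d) * (m * k)) * ((k + d) * (m * k)) + n * (m * d) * (m * d)
        ≡⟨ solve (k ∷ d ∷ m ∷ n ∷ []) ⟩
      2 * ((k + d) * (m * k)) * (m * ((k + d) * k)) + n * (m * d * (m * d))
        ≤⟨ bound ⟩
      (k + d) * (k + d) * S₂ + (k + d) * (k + d) * (m * k * (m * k))
        ≡⟨ cong (λ s → (k + d) * (k + d) * s + (k + d) * (k + d) * (m * k * (m * k))) S₂≡ ⟩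
      (k + d) * (k + d) * (m * (d * k) + m * (m * (k * k))) + (k + d) * (k + d) * (m * k * (m * k))
        ≡⟨ solve (k ∷ d ∷ m ∷ []) ⟩
      2 * ((k + d) * (m * k)) * ((k + d) * (m * k)) + (k + d) * (k + d) * k * (m * d)
        ∎))
    where
    open ℕ.≤-Reasoning
    S₂≡ : S₂ ≡ m * (d * k) + m * (m * (k * k))
    S₂≡ = ℕ.+-cancelʳ-≡ (m * (k * k)) S₂ _ (trans S₂-eq (solve (k ∷ d ∷ m ∷ [])))
    cancel-md : n * (m * d) * (m * d) ≤ (k + d) * (k + d) * k * (m * d) → n * (m * d) ≤ (k + d) * (k + d) * k
    cancel-md le with m * d ℕ.≟ 0
    ... | yes md≡0 = ℕ.≤-trans (ℕ.≤-reflexive (trans (cong (n *_) md≡0) (ℕ.*-zeroʳ n))) z≤n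
    ... | no  md≢0 = ℕ.*-cancelʳ-≤ _ _ (m * d) {{ℕ.≢-nonZero md≢0}} le

  a*m<2q² : ∀ {q k d m n a} → q ≡ k + d → k < d → n * (m * d) ≤ q * q * k → a ≤ 2 * n → a * m < 2 * (q * q)
  a*m<2q² {q} {k} {d} {m} {n} {a} q≡k+d k<d nmd≤qqk a≤2n = ℕ.*-cancelʳ-< d (a * m) (2 * (q * q)) (begin-strict
    a * m * d            ≤⟨ ℕ.*-monoˡ-≤ d (ℕ.*-monoˡ-≤ m a≤2n) ⟩
    2 * n * m * d        ≡⟨ solve (n ∷ m ∷ d ∷ []) ⟩
    2 * (n * (m * d))    ≤⟨ ℕ.*-monoʳ-≤ 2 nmd≤qqk ⟩
    2 * (q * q * k)      <⟨ ℕ.*-monoʳ-< 2 (ℕ.*-monoʳ-< (q * q) {{qq≢0}} k<d) ⟩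
    2 * (q * q * d)      ≡⟨ ℕ.*-assoc 2 (q * q) d ⟨
    2 * (q * q) * d      ∎)
    where
    open ℕ.≤-Reasoning
    0<q : 0 < q
    0<q = ℕ.<-≤-trans (ℕ.≤-<-trans z≤n k<d) (subst (d ≤_) (trans (ℕ.+-comm d k) (sym q≡k+d)) (ℕ.m≤m+n d k))
    qq≢0 : NonZero (q * q)
    qq≢0 = ℕ.m*n≢0 q q {{ℕ.>-nonZero 0<q}} {{ℕ.>-nonZero 0<q}}

open SecondMoment

oddPrimePower⇒odd : ∀ {q} → OddPrimePower q → q ≡ suc (q / 2 * 2)
oddPrimePower⇒odd (p , k , p-prime , p≢2 , refl) =
  trans (m≡m%n+[m/n]*n (p ^ k) 2) (cong (ℕ._+ p ^ k / 2 * 2) (p^k%2≡1 k))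
  where
  open import Data.Nat.DivMod using (m≡m%n+[m/n]*n; m%n<n; %-distribˡ-*)
  open import Data.Nat.Divisibility using (m%n≡0⇒n∣m)
  open import Data.Nat.Primality using (Prime; composite-≢; prime⇒nonZero)
  instance
    p≢0 : ℕ.NonZero p
    p≢0 = prime⇒nonZero p-prime
  p%2≡1 : p % 2 ≡ 1
  p%2≡1 with p % 2 in p%2≡r | m%n<n p 2
  ... | 0           | _ = ⊥-elim (Prime.notComposite p-prime (composite-≢ 2 (p≢2 ∘ sym) (m%n≡0⇒n∣m p 2 p%2≡r)))
  ... | 1           | _ = refl
  ... | suc (suc _) | s≤s (s≤s ())
  p^k%2≡1 : ∀ k → p ^ k % 2 ≡ 1
  p^k%2≡1 zero    = refl
  p^k%2≡1 (suc k) = trans (%-distribˡ-* p (p ^ k) 2) (cong₂ (λ x y → x * y % 2) p%2≡1 (p^k%2≡1 k))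

module IntegerRingSolver {c ℓ} (R : CommutativeRing c ℓ) where
  open ℤ using (ℤ; +_; -[1+_]; _⊖_; sign; ∣_∣; _◃_)
  import Data.Integer.Properties as ℤ
  open import Data.Maybe using (Maybe; just; nothing)
  open import Data.Sign as Sign using (Sign)
  open import Algebra.Solver.Ring.AlmostCommutativeRing using (fromCommutativeRing; _-Raw-AlmostCommutative⟶_)
  open CommutativeRing R
    renaming (_*_ to _·_; *-cong to ·-cong; refl to ≈-refl; sym to ≈-sym; trans to ≈-trans; reflexive to ≈-reflexive)
  open import Algebra.Properties.Ring ring using (-‿distribˡ-*; -‿distribʳ-*; -‿involutive; -0#≈0#; -‿+-comm)
  open import Algebra.Properties.CommutativeSemigroup +-commutativeSemigroup using (interchange)
  open import Algebra.Properties.Semiring.Mult.TCOptimised semiring using (_×_; 1+×; ×-homo-+; ×1-homo-*)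
  open import Relation.Binary.Reasoning.Setoid setoid

  -- With the optimised multiplication 1 × x and 2 × x reduce to x and x + x, so the solver
  -- constants con (+ 1) and con (+ 2) denote 1# and 1# + 1# on the nose.
  ⟦_⟧ℤ : ℤ → Carrier
  ⟦ + n ⟧ℤ      = n × 1#
  ⟦ -[1+ n ] ⟧ℤ = - (suc n × 1#)

  ⟦-+⟧ : ∀ n → ⟦ ℤ.- + n ⟧ℤ ≈ - (n × 1#)
  ⟦-+⟧ zero    = ≈-sym -0#≈0#
  ⟦-+⟧ (suc n) = ≈-refl

  ⟦-⟧ : ∀ i → ⟦ ℤ.- i ⟧ℤ ≈ - ⟦ i ⟧ℤ
  ⟦-⟧ (+ n)    = ⟦-+⟧ n
  ⟦-⟧ -[1+ n ] = ≈-sym (-‿involutive _)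

  ⟦⊖⟧ : ∀ m n → ⟦ m ⊖ n ⟧ℤ ≈ m × 1# - n × 1#
  ⟦⊖⟧ m       zero    = ≈-sym (≈-trans (+-congˡ -0#≈0#) (+-identityʳ _))
  ⟦⊖⟧ zero    (suc n) = ≈-sym (+-identityˡ _)
  ⟦⊖⟧ (suc m) (suc n) = begin
    ⟦ suc m ⊖ suc n ⟧ℤ                ≡⟨ cong ⟦_⟧ℤ (ℤ.[1+m]⊖[1+n]≡m⊖n m n) ⟩
    ⟦ m ⊖ n ⟧ℤ                        ≈⟨ ⟦⊖⟧ m n ⟩
    m × 1# - n × 1#                   ≈⟨ +-identityˡ _ ⟨
    0# + (m × 1# - n × 1#)            ≈⟨ +-congʳ (-‿inverseʳ 1#) ⟨
    (1# - 1#) + (m × 1# - n × 1#)     ≈⟨ interchange _ _ _ _ ⟩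
    (1# + m × 1#) + (- 1# - n × 1#)   ≈⟨ +-congˡ (-‿+-comm 1# (n × 1#)) ⟩
    (1# + m × 1#) - (1# + n × 1#)     ≈⟨ +-cong (1+× m 1#) (-‿cong (1+× n 1#)) ⟨
    suc m × 1# - suc n × 1#           ∎

  ⟦+⟧ : ∀ i j → ⟦ i ℤ.+ j ⟧ℤ ≈ ⟦ i ⟧ℤ + ⟦ j ⟧ℤ
  ⟦+⟧ (+ m)    (+ n)    = ×-homo-+ 1# m n
  ⟦+⟧ (+ m)    -[1+ n ] = ⟦⊖⟧ m (suc n)
  ⟦+⟧ -[1+ m ] (+ n)    = ≈-trans (⟦⊖⟧ n (suc m)) (+-comm _ _)
  ⟦+⟧ -[1+ m ] -[1+ n ] = begin
    - (suc (suc (m ℕ.+ n)) × 1#)    ≡⟨ cong (λ k → - (k × 1#)) (ℕ.+-suc (suc m) n) ⟨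
    - ((suc m ℕ.+ suc n) × 1#)      ≈⟨ -‿cong (×-homo-+ 1# (suc m) (suc n)) ⟩
    - (suc m × 1# + suc n × 1#)     ≈⟨ -‿+-comm _ _ ⟨
    ⟦ -[1+ m ] ⟧ℤ + ⟦ -[1+ n ] ⟧ℤ   ∎

  signed : Sign → Carrier → Carrier
  signed Sign.+ x = x
  signed Sign.- x = - x

  signed-cong : ∀ s {x y} → x ≈ y → signed s x ≈ signed s y
  signed-cong Sign.+ x≈y = x≈y
  signed-cong Sign.- x≈y = -‿cong x≈y

  signed-· : ∀ s t x y → signed (s Sign.* t) (x · y) ≈ signed s x · signed t y
  signed-· Sign.+ Sign.+ x y = ≈-refl
  signed-· Sign.+ Sign.- x y = -‿distribʳ-* x y
  signed-· Sign.- Sign.+ x y = -‿distribˡ-* x y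
  signed-· Sign.- Sign.- x y = begin
    x · y          ≈⟨ -‿involutive _ ⟨
    - - (x · y)    ≈⟨ -‿cong (-‿distribʳ-* x y) ⟩
    - (x · - y)    ≈⟨ -‿distribˡ-* x (- y) ⟩
    - x · - y      ∎

  ⟦◃⟧ : ∀ s n → ⟦ s ◃ n ⟧ℤ ≈ signed s (n × 1#)
  ⟦◃⟧ Sign.+ n = ≈-reflexive (cong ⟦_⟧ℤ (ℤ.+◃n≡+n n))
  ⟦◃⟧ Sign.- n = ≈-trans (≈-reflexive (cong ⟦_⟧ℤ (ℤ.-◃n≡-n n))) (⟦-+⟧ n)

  ⟦⟧ℤ-signed : ∀ i → ⟦ i ⟧ℤ ≈ signed (sign i) (∣ i ∣ × 1#)
  ⟦⟧ℤ-signed (+ n)    = ≈-refl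
  ⟦⟧ℤ-signed -[1+ n ] = ≈-refl

  ⟦*⟧ : ∀ i j → ⟦ i ℤ.* j ⟧ℤ ≈ ⟦ i ⟧ℤ · ⟦ j ⟧ℤ
  ⟦*⟧ i j = begin
    ⟦ sign i Sign.* sign j ◃ ∣ i ∣ ℕ.* ∣ j ∣ ⟧ℤ                  ≈⟨ ⟦◃⟧ (sign i Sign.* sign j) (∣ i ∣ ℕ.* ∣ j ∣) ⟩
    signed (sign i Sign.* sign j) ((∣ i ∣ ℕ.* ∣ j ∣) × 1#)
      ≈⟨ signed-cong (sign i Sign.* sign j) (×1-homo-* ∣ i ∣ ∣ j ∣) ⟩
    signed (sign i Sign.* sign j) (∣ i ∣ × 1# · ∣ j ∣ × 1#)      ≈⟨ signed-· (sign i) (sign j) _ _ ⟩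
    signed (sign i) (∣ i ∣ × 1#) · signed (sign j) (∣ j ∣ × 1#)   ≈⟨ ·-cong (⟦⟧ℤ-signed i) (⟦⟧ℤ-signed j) ⟨
    ⟦ i ⟧ℤ · ⟦ j ⟧ℤ                                              ∎

  homomorphism : ℤ.+-*-rawRing -Raw-AlmostCommutative⟶ fromCommutativeRing R
  homomorphism = record
    { ⟦_⟧    = ⟦_⟧ℤ
    ; +-homo = ⟦+⟧
    ; *-homo = ⟦*⟧
    ; -‿homo = ⟦-⟧
    ; 0-homo = ≈-refl
    ; 1-homo = ≈-refl
    }

  ⟦⟧ℤ-≟ : ∀ i j → Maybe (⟦ i ⟧ℤ ≈ ⟦ j ⟧ℤ)
  ⟦⟧ℤ-≟ i j with i ℤ.≟ j
  ... | yes refl = just ≈-refl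
  ... | no  _    = nothing

  open import Algebra.Solver.Ring ℤ.+-*-rawRing (fromCommutativeRing R) homomorphism ⟦⟧ℤ-≟ public

module FiniteFieldProperties {q : ℕ} (F : FiniteField q) where
  open FiniteField F
  open import Level using (0ℓ)
  open import Data.List.Membership.Propositional using (_∈_; lose)
  open import Data.List.Membership.Propositional.Properties using (∈-map⁺; ∈-allFin; ∈-cartesianProduct⁺)
  open import Data.List.Relation.Unary.Any.Properties using (any⁺)
  open import Relation.Nullary.Decidable using (dec-true)

  commutativeRing : CommutativeRing 0ℓ 0ℓ
  commutativeRing = record { isCommutativeRing = isCommutativeRing }

  open CommutativeRing commutativeRing
    using (+-identityˡ; +-identityʳ; +-assoc; *-identityˡ; zeroʳ; +-monoid; +-commutativeMonoid)
  open import Algebra.Properties.Ring (CommutativeRing.ring commutativeRing) using (+-identityʳ-unique)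
  open import Algebra.Properties.Monoid.Mult +-monoid using (_×_)
  open IntegerRingSolver commutativeRing using (solve; _:=_; _:+_; _:*_; _:-_; con)

  instance
    carrier-finite : Finite Carrier
    carrier-finite = record { size = q ; enumeration = enum }

  2# : Carrier
  2# = 1# + 1#

  x≢0∧xy≡0⇒y≡0 : ∀ {x y} → x ≢ 0# → x · y ≡ 0# → y ≡ 0#
  x≢0∧xy≡0⇒y≡0 {x} {y} x≢0 xy≡0 = begin
    y                ≡⟨ *-identityˡ y ⟨
    1# · y           ≡⟨ cong (_· y) x·x⁻¹≡1 ⟨
    x · x⁻¹ · y      ≡⟨ solve 3 (λ x x⁻¹ y → x :* x⁻¹ :* y := x⁻¹ :* (x :* y)) refl x x⁻¹ y ⟩
    x⁻¹ · (x · y)    ≡⟨ cong (x⁻¹ ·_) xy≡0 ⟩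
    x⁻¹ · 0#         ≡⟨ zeroʳ x⁻¹ ⟩
    0#               ∎
    where
    open ≡-Reasoning
    x⁻¹ : Carrier
    x⁻¹ = proj₁ (inverse x x≢0)
    x·x⁻¹≡1 : x · x⁻¹ ≡ 1#
    x·x⁻¹≡1 = proj₂ (inverse x x≢0)

  x-y≡0⇒x≡y : ∀ {x y} → x - y ≡ 0# → x ≡ y
  x-y≡0⇒x≡y {x} {y} x-y≡0 = begin
    x            ≡⟨ solve 2 (λ x y → x := x :- y :+ y) refl x y ⟩
    x - y + y    ≡⟨ cong (_+ y) x-y≡0 ⟩
    0# + y       ≡⟨ +-identityˡ y ⟩
    y            ∎
    where open ≡-Reasoning

  translation : Carrier → Carrier ↔ Carrier
  translation β = mk↔ₛ′ (_+ β) (_- β)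
    (λ y → solve 2 (λ y β → y :- β :+ β := y) refl y β)
    (λ x → solve 2 (λ x β → x :+ β :- β := x) refl x β)

  affinity : ∀ ρ β → ρ ≢ 0# → Carrier ↔ Carrier
  affinity ρ β ρ≢0 = mk↔ₛ′ (λ u → ρ · u + β) (λ v → ρ⁻¹ · (v - β)) to∘from from∘to
    where
    open ≡-Reasoning
    ρ⁻¹ : Carrier
    ρ⁻¹ = proj₁ (inverse ρ ρ≢0)
    ρ·ρ⁻¹≡1 : ρ · ρ⁻¹ ≡ 1#
    ρ·ρ⁻¹≡1 = proj₂ (inverse ρ ρ≢0)
    to∘from : ∀ v → ρ · (ρ⁻¹ · (v - β)) + β ≡ v
    to∘from v = begin
      ρ · (ρ⁻¹ · (v - β)) + β  ≡⟨ solve 4 (λ ρ ρ⁻¹ v β → ρ :* (ρ⁻¹ :* (v :- β)) :+ β := ρ :* ρ⁻¹ :* (v :- β) :+ β)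
                                          refl ρ ρ⁻¹ v β ⟩
      ρ · ρ⁻¹ · (v - β) + β    ≡⟨ cong (λ c → c · (v - β) + β) ρ·ρ⁻¹≡1 ⟩
      1# · (v - β) + β         ≡⟨ solve 2 (λ v β → con (ℤ.+ 1) :* (v :- β) :+ β := v) refl v β ⟩
      v                        ∎
    from∘to : ∀ u → ρ⁻¹ · (ρ · u + β - β) ≡ u
    from∘to u = begin
      ρ⁻¹ · (ρ · u + β - β)    ≡⟨ solve 4 (λ ρ ρ⁻¹ u β → ρ⁻¹ :* (ρ :* u :+ β :- β) := ρ :* ρ⁻¹ :* u) refl ρ ρ⁻¹ u β ⟩
      ρ · ρ⁻¹ · u              ≡⟨ cong (_· u) ρ·ρ⁻¹≡1 ⟩
      1# · u                   ≡⟨ *-identityˡ u ⟩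
      u                        ∎

  ∑-translate : ∀ (f : Carrier → ℕ) β → ∑ (λ x → f (x + β)) ≡ ∑ f
  ∑-translate f β = ∑-reindex (translation β) f

  ∑-affine : ∀ (f : Carrier → ℕ) {ρ} β → ρ ≢ 0# → ∑ (λ u → f (ρ · u + β)) ≡ ∑ f
  ∑-affine f β ρ≢0 = ∑-reindex (affinity _ β ρ≢0) f

  q×1≡0 : q × 1# ≡ 0#
  q×1≡0 = +-identityʳ-unique total (q × 1#) (sym shifted)
    where
    open ≡-Reasoning
    open import Algebra.Properties.CommutativeMonoid.Sum +-commutativeMonoid as Σ using ()
    open Finite carrier-finite using (element; index; element-index)
    total : Carrier
    total = Σ.sum element
    shifted : total ≡ total + q × 1#
    shifted = begin
      total                                        ≡⟨ Σ.∑-permute element (induced-permutation (translation 1#)) ⟩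
      Σ.sum (λ i → element (index (element i + 1#))) ≡⟨ Σ.sum-cong-≗ (λ i → element-index (element i + 1#)) ⟩
      Σ.sum (λ i → element i + 1#)                 ≡⟨ Σ.∑-distrib-+ element (λ _ → 1#) ⟩
      total + Σ.sum {q} (λ _ → 1#)                 ≡⟨ cong (total +_) (Σ.sum-replicate q) ⟩
      total + q × 1#                               ∎

  odd⇒2≢0 : ∀ {j} → q ≡ suc (j * 2) → 2# ≢ 0#
  odd⇒2≢0 {j} q≡2j+1 2≡0 = 0≢1 (begin
    0#                  ≡⟨ q×1≡0 ⟨
    q × 1#              ≡⟨ cong (_× 1#) q≡2j+1 ⟩
    suc (j * 2) × 1#    ≡⟨ odd×1≡1 j ⟩
    1#                  ∎)
    where
    open ≡-Reasoning
    odd×1≡1 : ∀ j → suc (j * 2) × 1# ≡ 1#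
    odd×1≡1 zero    = +-identityʳ 1#
    odd×1≡1 (suc j) = begin
      1# + (1# + suc (j * 2) × 1#) ≡⟨ +-assoc 1# 1# _ ⟨
      2# + suc (j * 2) × 1#        ≡⟨ cong₂ _+_ 2≡0 (odd×1≡1 j) ⟩
      0# + 1#                      ≡⟨ +-identityˡ 1# ⟩
      1#                           ∎

  quadratic-fibre≤2 : ∀ {α} β γ → α ≢ 0# → count (λ y → ⌊ (α · (y · y) + β · y) ≟ γ ⌋) ≤ 2
  quadratic-fibre≤2 {α} β γ α≢0 = count≤2 (λ y → ⌊ f y ≟ γ ⌋) no-three
    where
    open ≡-Reasoning
    f : Carrier → Carrier
    f y = α · (y · y) + β · y
    root-sum : ∀ {x y} → f x ≡ f y → x ≢ y → α · (x + y) + β ≡ 0#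
    root-sum {x} {y} fx≡fy x≢y = x≢0∧xy≡0⇒y≡0 (x≢y ∘ x-y≡0⇒x≡y) (begin
      (x - y) · (α · (x + y) + β)
        ≡⟨ solve 4 (λ α β x y → (x :- y) :* (α :* (x :+ y) :+ β)
                              := α :* (x :* x) :+ β :* x :- (α :* (y :* y) :+ β :* y)) refl α β x y ⟩
      f x - f y    ≡⟨ cong (_- f y) fx≡fy ⟩
      f y - f y    ≡⟨ solve 1 (λ z → z :- z := con (ℤ.+ 0)) refl (f y) ⟩
      0#           ∎)
    no-three : ∀ {x y z} → T ⌊ f x ≟ γ ⌋ → T ⌊ f y ≟ γ ⌋ → T ⌊ f z ≟ γ ⌋ → x ≢ y → x ≢ z → y ≡ z
    no-three {x} {y} {z} fx≡γ fy≡γ fz≡γ x≢y x≢z = x-y≡0⇒x≡y (x≢0∧xy≡0⇒y≡0 α≢0 (begin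
      α · (y - z)
        ≡⟨ solve 5 (λ α β x y z → α :* (y :- z) := α :* (x :+ y) :+ β :- (α :* (x :+ z) :+ β)) refl α β x y z ⟩
      (α · (x + y) + β) - (α · (x + z) + β)
        ≡⟨ cong₂ _-_ (root-sum (trans (toWitness fx≡γ) (sym (toWitness fy≡γ))) x≢y)
                     (root-sum (trans (toWitness fx≡γ) (sym (toWitness fz≡γ))) x≢z) ⟩
      0# - 0#
        ≡⟨ solve 1 (λ z → z :- z := con (ℤ.+ 0)) refl 0# ⟩
      0#
        ∎))

  ∑-elements : ∀ (f : Carrier → ℕ) → ℕ.sum (List.map f elements) ≡ ∑ f
  ∑-elements f = begin
    ℕ.sum (List.map f (List.map element (List.allFin q)))   ≡⟨ cong ℕ.sum (List.map-∘ (List.allFin q)) ⟨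
    ℕ.sum (List.map (f ∘ element) (List.allFin q))          ≡⟨ cong ℕ.sum (List.map-tabulate id (f ∘ element)) ⟩
    ℕ.sum (List.tabulate (f ∘ element))                     ≡⟨ sum-tabulate (f ∘ element) ⟩
    ∑ f                                                     ∎
    where
    open ≡-Reasoning
    open Finite carrier-finite using (element)

  card²≡count : ∀ S → card² S ≡ count S
  card²≡count S = begin
    card² S
      ≡⟨ length-filter≡sum S points ⟩
    ℕ.sum (List.map (𝟙 ∘ S) points)
      ≡⟨ sum-cartesianProduct (𝟙 ∘ S) elements elements ⟩
    ℕ.sum (List.map (λ x₁ → ℕ.sum (List.map (λ x₂ → 𝟙 (S (x₁ , x₂))) elements)) elements)
      ≡⟨ ∑-elements (λ x₁ → ℕ.sum (List.map (λ x₂ → 𝟙 (S (x₁ , x₂))) elements)) ⟩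
    ∑ (λ x₁ → ℕ.sum (List.map (λ x₂ → 𝟙 (S (x₁ , x₂))) elements))
      ≡⟨ ∑-cong (λ x₁ → ∑-elements (λ x₂ → 𝟙 (S (x₁ , x₂)))) ⟩
    ∑ (λ x₁ → ∑ (λ x₂ → 𝟙 (S (x₁ , x₂))))
      ≡⟨ ∑-× (𝟙 ∘ S) ⟨
    count S
      ∎
    where open ≡-Reasoning

  cardΔ≡count : ∀ A B → cardΔ A B ≡ count (Δ A B)
  cardΔ≡count A B = trans (length-filter≡sum (Δ A B) elements) (∑-elements (𝟙 ∘ Δ A B))

  Δ-witness : ∀ {A B x y} → x ∈ᵇ A → y ∈ᵇ B → T (Δ A B ‖ x -ᵖ y ‖)
  Δ-witness {A} {B} {x} {y} x∈A y∈B = any⁺ _ (lose (∈-points x) (any⁺ _ (lose (∈-points y) witness)))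
    where
    ∈-elements : ∀ z → z ∈ elements
    ∈-elements z = subst (_∈ elements) (Inverse.strictlyInverseʳ enum z)
                         (∈-map⁺ (Inverse.from enum) (∈-allFin (Inverse.to enum z)))
    ∈-points : ∀ p → p ∈ points
    ∈-points (p₁ , p₂) = ∈-cartesianProduct⁺ (∈-elements p₁) (∈-elements p₂)
    witness : T (A x ∧ B y ∧ does (‖ x -ᵖ y ‖ ≟ ‖ x -ᵖ y ‖))
    witness rewrite x∈A | y∈B | dec-true (‖ x -ᵖ y ‖ ≟ ‖ x -ᵖ y ‖) refl = _

module LineGeometry {q : ℕ} (F : FiniteField q) (a b l : FiniteField.Carrier F) where
  open FiniteField F
  open FiniteFieldProperties F
  open IntegerRingSolver commutativeRing using (solve; _:=_; _:+_; _:*_; _:-_; :-_; con)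

  μ : Carrier
  μ = 1# + l · l

  onLine : Carrier → Point
  onLine s = (s + a , l · s + b)

  quadratic : Point → Carrier → Carrier
  quadratic (c₀ , u) s = c₀ + (μ · (s · s) - 2# · (u · s))

  coordinates : Point → Point
  coordinates (x₁ , x₂) = (‖ (x₁ - a , x₂ - b) ‖ , (x₁ - a) + l · (x₂ - b))

  distance-onLine : ∀ x s → ‖ x -ᵖ onLine s ‖ ≡ quadratic (coordinates x) s
  distance-onLine (x₁ , x₂) s = solve 6 (λ x₁ x₂ s a b l →
      (x₁ :- (s :+ a)) :* (x₁ :- (s :+ a)) :+ (x₂ :- (l :* s :+ b)) :* (x₂ :- (l :* s :+ b))
    := (x₁ :- a) :* (x₁ :- a) :+ (x₂ :- b) :* (x₂ :- b)
         :+ ((con (ℤ.+ 1) :+ l :* l) :* (s :* s) :- con (ℤ.+ 2) :* (((x₁ :- a) :+ l :* (x₂ :- b)) :* s)))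
    refl x₁ x₂ s a b l

  ∈L⇒ordinate : ∀ {x₁ x₂} → (x₁ , x₂) ∈L[ l , a , b ] → x₂ ≡ l · (x₁ - a) + b
  ∈L⇒ordinate {x₁} {x₂} (s , t , t≡ls , p≡) = begin
    x₂                    ≡⟨ cong proj₂ p≡ ⟩
    t + b                 ≡⟨ cong (_+ b) t≡ls ⟩
    l · s + b             ≡⟨ solve 4 (λ l s a b → l :* s :+ b := l :* (s :+ a :- a) :+ b) refl l s a b ⟩
    l · (s + a - a) + b   ≡⟨ cong (λ x → l · (x - a) + b) (cong proj₁ p≡) ⟨
    l · (x₁ - a) + b      ∎
    where open ≡-Reasoning

  count-onLine : ∀ {S} → (∀ p → p ∈ᵇ S → p ∈L[ l , a , b ]) → count S ≡ count (S ∘ onLine)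
  count-onLine {S} S⊆L = begin
    count S                                          ≡⟨ ∑-× (𝟙 ∘ S) ⟩
    ∑ (λ x₁ → ∑ (λ x₂ → 𝟙 (S (x₁ , x₂))))            ≡⟨ ∑-cong (λ x₁ → ∑-single _ (l · (x₁ - a) + b) (off-line x₁)) ⟩
    ∑ (λ x₁ → 𝟙 (S (x₁ , l · (x₁ - a) + b)))         ≡⟨ ∑-translate (λ x₁ → 𝟙 (S (x₁ , l · (x₁ - a) + b))) a ⟨
    ∑ (λ s → 𝟙 (S (s + a , l · (s + a - a) + b)))    ≡⟨ ∑-cong (λ s → cong (λ y → 𝟙 (S (s + a , y))) (ordinate s)) ⟩
    count (S ∘ onLine)                               ∎
    where
    open ≡-Reasoning
    off-line : ∀ x₁ x₂ → x₂ ≢ l · (x₁ - a) + b → 𝟙 (S (x₁ , x₂)) ≡ 0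
    off-line x₁ x₂ x₂≢ with S (x₁ , x₂) in S∋x
    ... | true  = ⊥-elim (x₂≢ (∈L⇒ordinate (S⊆L (x₁ , x₂) S∋x)))
    ... | false = refl
    ordinate : ∀ s → l · (s + a - a) + b ≡ l · s + b
    ordinate s = solve 4 (λ l s a b → l :* (s :+ a :- a) :+ b := l :* s :+ b) refl l s a b

  ∑-quadratic : ∀ (f : Carrier → ℕ) s → ∑ (λ c → f (quadratic c s)) ≡ q * ∑ f
  ∑-quadratic f s = begin
    ∑ (λ c → f (quadratic c s))                   ≡⟨ ∑-× (λ c → f (quadratic c s)) ⟩
    ∑ (λ c₀ → ∑ (λ u → f (c₀ + α u)))             ≡⟨ ∑-comm (λ c₀ u → f (c₀ + α u)) ⟩
    ∑ (λ u → ∑ (λ c₀ → f (c₀ + α u)))             ≡⟨ ∑-cong (λ u → ∑-translate f (α u)) ⟩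
    ∑ (λ (_ : Carrier) → ∑ f)                     ≡⟨ ∑-const {A = Carrier} (∑ f) ⟩
    q * ∑ f                                       ∎
    where
    open ≡-Reasoning
    α : Carrier → Carrier
    α u = μ · (s · s) - 2# · (u · s)

  -- c ↦ (quadratic c s , quadratic c s') is an affine bijection of 𝔽q², of determinant 2 (s − s').
  ∑-quadratic-pair : 2# ≢ 0# → ∀ (f g : Carrier → ℕ) {s s'} → s ≢ s' →
    ∑ (λ c → f (quadratic c s) * g (quadratic c s')) ≡ ∑ f * ∑ g
  ∑-quadratic-pair 2≢0 f g {s} {s'} s≢s' = begin
    ∑ (λ c → f (quadratic c s) * g (quadratic c s'))
      ≡⟨ ∑-× (λ c → f (quadratic c s) * g (quadratic c s')) ⟩
    ∑ (λ c₀ → ∑ (λ u → f (c₀ + α u) * g (c₀ + α' u)))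
      ≡⟨ ∑-comm (λ c₀ u → f (c₀ + α u) * g (c₀ + α' u)) ⟩
    ∑ (λ u → ∑ (λ c₀ → f (c₀ + α u) * g (c₀ + α' u)))
      ≡⟨ ∑-cong shift-c₀ ⟩
    ∑ (λ u → ∑ (λ c₀ → f c₀ * g (ρ · u + (c₀ + β))))
      ≡⟨ ∑-comm (λ u c₀ → f c₀ * g (ρ · u + (c₀ + β))) ⟩
    ∑ (λ c₀ → ∑ (λ u → f c₀ * g (ρ · u + (c₀ + β))))
      ≡⟨ ∑-cong (λ c₀ → ∑-*ˡ (f c₀) (λ u → g (ρ · u + (c₀ + β)))) ⟩
    ∑ (λ c₀ → f c₀ * ∑ (λ u → g (ρ · u + (c₀ + β))))
      ≡⟨ ∑-cong (λ c₀ → cong (f c₀ *_) (∑-affine g (c₀ + β) ρ≢0)) ⟩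
    ∑ (λ c₀ → f c₀ * ∑ g)
      ≡⟨ ∑-*ʳ (∑ g) f ⟩
    ∑ f * ∑ g
      ∎
    where
    open ≡-Reasoning
    α α' : Carrier → Carrier
    α  u = μ · (s · s) - 2# · (u · s)
    α' u = μ · (s' · s') - 2# · (u · s')
    ρ β : Carrier
    ρ = 2# · (s - s')
    β = μ · (s' · s' - s · s)
    ρ≢0 : ρ ≢ 0#
    ρ≢0 ρ≡0 = s≢s' (x-y≡0⇒x≡y (x≢0∧xy≡0⇒y≡0 2≢0 ρ≡0))
    difference : ∀ c₀ u → c₀ + α' u ≡ ρ · u + (c₀ + α u + β)
    difference c₀ u = solve 5 (λ c₀ u s s' μ →
        c₀ :+ (μ :* (s' :* s') :- con (ℤ.+ 2) :* (u :* s'))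
      := con (ℤ.+ 2) :* (s :- s') :* u
           :+ (c₀ :+ (μ :* (s :* s) :- con (ℤ.+ 2) :* (u :* s)) :+ μ :* (s' :* s' :- s :* s)))
      refl c₀ u s s' μ
    shift-c₀ : ∀ u → ∑ (λ c₀ → f (c₀ + α u) * g (c₀ + α' u)) ≡ ∑ (λ c₀ → f c₀ * g (ρ · u + (c₀ + β)))
    shift-c₀ u = trans (∑-cong (λ c₀ → cong (λ x → f (c₀ + α u) * g x) (difference c₀ u)))
                       (∑-translate (λ c₀ → f c₀ * g (ρ · u + (c₀ + β))) (α u))

  coordinates≡⇒abscissa : ∀ {x₁ y c₀ u} → coordinates (x₁ , y + b) ≡ (c₀ , u) → x₁ ≡ u - l · y + a
  coordinates≡⇒abscissa {x₁} {y} refl =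
    solve 5 (λ x₁ y a b l → x₁ := x₁ :- a :+ l :* (y :+ b :- b) :- l :* y :+ a) refl x₁ y a b l

  coordinates≡⇒root : ∀ {x₁ y c₀ u} → coordinates (x₁ , y + b) ≡ (c₀ , u) →
    μ · (y · y) + - (2# · (l · u)) · y ≡ c₀ - u · u
  coordinates≡⇒root {x₁} {y} refl = solve 5 (λ x₁ y a b l →
      (con (ℤ.+ 1) :+ l :* l) :* (y :* y) :+ (:- (con (ℤ.+ 2) :* (l :* (x₁ :- a :+ l :* (y :+ b :- b))))) :* y
    := (x₁ :- a) :* (x₁ :- a) :+ (y :+ b :- b) :* (y :+ b :- b)
         :- (x₁ :- a :+ l :* (y :+ b :- b)) :* (x₁ :- a :+ l :* (y :+ b :- b)))
    refl x₁ y a b l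

  coordinates-fibre≤2 : μ ≢ 0# → ∀ c → count (λ x → ⌊ coordinates x ≟ₑ c ⌋) ≤ 2
  coordinates-fibre≤2 μ≢0 c@(c₀ , u) = begin
    count (λ x → ⌊ coordinates x ≟ₑ c ⌋)                      ≡⟨ ∑-× (λ x → 𝟙 ⌊ coordinates x ≟ₑ c ⌋) ⟩
    ∑ (λ x₁ → ∑ (λ x₂ → 𝟙 ⌊ coordinates (x₁ , x₂) ≟ₑ c ⌋))    ≡⟨ ∑-comm (λ x₁ x₂ → 𝟙 ⌊ coordinates (x₁ , x₂) ≟ₑ c ⌋) ⟩
    ∑ (λ x₂ → ∑ (λ x₁ → 𝟙 ⌊ coordinates (x₁ , x₂) ≟ₑ c ⌋))    ≡⟨ ∑-translate column b ⟨
    ∑ (λ y → column (y + b))                                 ≤⟨ ∑-mono-≤ column≤ ⟩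
    count (λ y → ⌊ (μ · (y · y) + β · y) ≟ γ ⌋)               ≤⟨ quadratic-fibre≤2 β γ μ≢0 ⟩
    2                                                        ∎
    where
    open ℕ.≤-Reasoning
    β γ : Carrier
    β = - (2# · (l · u))
    γ = c₀ - u · u
    column : Carrier → ℕ
    column x₂ = ∑ (λ x₁ → 𝟙 ⌊ coordinates (x₁ , x₂) ≟ₑ c ⌋)
    column≤ : ∀ y → column (y + b) ≤ 𝟙 ⌊ (μ · (y · y) + β · y) ≟ γ ⌋
    column≤ y = begin
      column (y + b)
        ≡⟨ ∑-single (λ x₁ → 𝟙 ⌊ coordinates (x₁ , y + b) ≟ₑ c ⌋) (u - l · y + a)
                    (λ x₁ x₁≢ → 𝟙-¬T (x₁≢ ∘ coordinates≡⇒abscissa ∘ toWitness)) ⟩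
      𝟙 ⌊ coordinates (u - l · y + a , y + b) ≟ₑ c ⌋
        ≤⟨ 𝟙-mono (fromWitness ∘ coordinates≡⇒root ∘ toWitness) ⟩
      𝟙 ⌊ (μ · (y · y) + β · y) ≟ γ ⌋
        ∎

module LineDistances {q : ℕ} (F : FiniteField q) where
  open FiniteField F using (Carrier; Point; 0#; Subset²; _∈ᵇ_; _∈L[_,_,_]; Δ; card²; cardΔ)
  open FiniteFieldProperties F using (2#; carrier-finite; card²≡count; cardΔ≡count; Δ-witness)
  open import Data.Nat using (_+_)
  open import Algebra.Properties.CommutativeSemigroup ℕ.*-commutativeSemigroup
    using () renaming (interchange to *-interchange)

  module _ (a b l : Carrier) (2≢0 : 2# ≢ 0#) (μ≢0 : LineGeometry.μ F a b l ≢ 0#)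
           (A B : Subset²) (B⊆L : ∀ p → p ∈ᵇ B → p ∈L[ l , a , b ]) where
    open LineGeometry F a b l

    inB : Carrier → Bool
    inB s = B (onLine s)

    m k : ℕ
    m = count inB
    k = count (Δ A B)

    inΔ : Point → Carrier → ℕ
    inΔ c s = 𝟙 (Δ A B (quadratic c s))

    hit : Point → Carrier → ℕ
    hit c s = 𝟙 (inB s) * inΔ c s

    hits : Point → ℕ
    hits c = ∑ (hit c)

    hitsAll : Point → Bool
    hitsAll c = ⌊ hits c ℕ.≟ m ⌋

    n : ℕ
    n = count hitsAll

    hits-coordinates : ∀ {x} → x ∈ᵇ A → hits (coordinates x) ≡ m
    hits-coordinates {x} x∈A = ∑-cong (λ s → 𝟙*𝟙≡𝟙 (λ s∈B →
      subst (T ∘ Δ A B) (distance-onLine x s) (Δ-witness {A} {B} x∈A (Equivalence.to T-≡ s∈B))))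

    |A|≤2n : count A ≤ 2 * n
    |A|≤2n = count≤bounded-fibres coordinates A hitsAll 2
      (λ x∈A → fromWitness (hits-coordinates (Equivalence.to T-≡ x∈A))) (coordinates-fibre≤2 μ≢0)

    ∑-hits : ∑ hits ≡ m * (q * k)
    ∑-hits = begin
      ∑ (λ c → ∑ (hit c))                        ≡⟨ ∑-comm hit ⟩
      ∑ (λ s → ∑ (λ c → 𝟙 (inB s) * inΔ c s))   ≡⟨ ∑-cong (λ s → ∑-*ˡ (𝟙 (inB s)) (λ c → inΔ c s)) ⟩
      ∑ (λ s → 𝟙 (inB s) * ∑ (λ c → inΔ c s))   ≡⟨ ∑-cong (λ s → cong (𝟙 (inB s) *_) (∑-quadratic (𝟙 ∘ Δ A B) s)) ⟩
      ∑ (λ s → 𝟙 (inB s) * (q * k))             ≡⟨ ∑-*ʳ (q * k) (𝟙 ∘ inB) ⟩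
      m * (q * k)                               ∎
      where open ≡-Reasoning

    common : Carrier → Carrier → ℕ
    common s s' = ∑ (λ c → inΔ c s * inΔ c s')

    common-diagonal : ∀ s → common s s ≡ q * k
    common-diagonal s = trans (∑-cong (λ c → 𝟙*𝟙≡𝟙 {Δ A B (quadratic c s)} id)) (∑-quadratic (𝟙 ∘ Δ A B) s)

    common-off-diagonal : ∀ s s' → s ≢ s' → common s s' ≡ k * k
    common-off-diagonal s s' = ∑-quadratic-pair 2≢0 (𝟙 ∘ Δ A B) (𝟙 ∘ Δ A B)

    ∑-hit-pair : ∀ s s' → ∑ (λ c → hit c s * hit c s') ≡ 𝟙 (inB s) * (𝟙 (inB s') * common s s')
    ∑-hit-pair s s' = begin
      ∑ (λ c → hit c s * hit c s')
        ≡⟨ ∑-cong (λ c → regroup (inΔ c s) (inΔ c s')) ⟩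
      ∑ (λ c → 𝟙 (inB s) * (𝟙 (inB s') * (inΔ c s * inΔ c s')))
        ≡⟨ ∑-*ˡ (𝟙 (inB s)) (λ c → 𝟙 (inB s') * (inΔ c s * inΔ c s')) ⟩
      𝟙 (inB s) * ∑ (λ c → 𝟙 (inB s') * (inΔ c s * inΔ c s'))
        ≡⟨ cong (𝟙 (inB s) *_) (∑-*ˡ (𝟙 (inB s')) (λ c → inΔ c s * inΔ c s')) ⟩
      𝟙 (inB s) * (𝟙 (inB s') * common s s')
        ∎
      where
      open ≡-Reasoning
      regroup : ∀ v v' → 𝟙 (inB s) * v * (𝟙 (inB s') * v') ≡ 𝟙 (inB s) * (𝟙 (inB s') * (v * v'))
      regroup v v' =
        trans (*-interchange (𝟙 (inB s)) v (𝟙 (inB s')) v') (ℕ.*-assoc (𝟙 (inB s)) (𝟙 (inB s')) (v * v'))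

    ∑-hits-square : ∑ (λ c → hits c * hits c) ≡ ∑ (λ s → 𝟙 (inB s) * ∑ (λ s' → 𝟙 (inB s') * common s s'))
    ∑-hits-square = begin
      ∑ (λ c → hits c * hits c)
        ≡⟨ ∑-cong (λ c → ∑-square (hit c)) ⟩
      ∑ (λ c → ∑ (λ s → ∑ (λ s' → hit c s * hit c s')))
        ≡⟨ ∑-comm (λ c s → ∑ (λ s' → hit c s * hit c s')) ⟩
      ∑ (λ s → ∑ (λ c → ∑ (λ s' → hit c s * hit c s')))
        ≡⟨ ∑-cong (λ s → ∑-comm (λ c s' → hit c s * hit c s')) ⟩
      ∑ (λ s → ∑ (λ s' → ∑ (λ c → hit c s * hit c s')))
        ≡⟨ ∑-cong (λ s → ∑-cong (∑-hit-pair s)) ⟩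
      ∑ (λ s → ∑ (λ s' → 𝟙 (inB s) * (𝟙 (inB s') * common s s')))
        ≡⟨ ∑-cong (λ s → ∑-*ˡ (𝟙 (inB s)) (λ s' → 𝟙 (inB s') * common s s')) ⟩
      ∑ (λ s → 𝟙 (inB s) * ∑ (λ s' → 𝟙 (inB s') * common s s'))
        ∎
      where open ≡-Reasoning

    ∑-hits² : ∑ (λ c → hits c * hits c) + m * (k * k) ≡ m * (q * k + m * (k * k))
    ∑-hits² = trans (cong (_+ m * (k * k)) ∑-hits-square)
                    (∑-pairs inB common (q * k) (k * k) common-diagonal common-off-diagonal)

    ∑-chebyshev : ∀ d → q ≡ k + d →
      2 * (q * (m * k)) * ∑ hits + n * (m * d * (m * d)) ≤
      q * q * ∑ (λ c → hits c * hits c) + q * q * (m * k * (m * k))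
    ∑-chebyshev d q≡k+d = begin
      2 * (q * (m * k)) * ∑ hits + n * (m * d * (m * d))
        ≡⟨ cong₂ _+_ (∑-*ˡ (2 * (q * (m * k))) hits) (∑-*ʳ (m * d * (m * d)) (𝟙 ∘ hitsAll)) ⟨
      ∑ (λ c → 2 * (q * (m * k)) * hits c) + ∑ (λ c → 𝟙 (hitsAll c) * (m * d * (m * d)))
        ≡⟨ ∑-distrib-+ (λ c → 2 * (q * (m * k)) * hits c) (λ c → 𝟙 (hitsAll c) * (m * d * (m * d))) ⟨
      ∑ (λ c → 2 * (q * (m * k)) * hits c + 𝟙 (hitsAll c) * (m * d * (m * d)))
        ≤⟨ ∑-mono-≤ (λ c → chebyshev-term k d m (hits c) q≡k+d) ⟩
      ∑ (λ c → q * q * (hits c * hits c) + m * k * (m * k))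
        ≡⟨ ∑-distrib-+ (λ c → q * q * (hits c * hits c)) (λ _ → m * k * (m * k)) ⟩
      ∑ (λ c → q * q * (hits c * hits c)) + ∑ (λ (_ : Point) → m * k * (m * k))
        ≡⟨ cong₂ _+_ (∑-*ˡ (q * q) (λ c → hits c * hits c)) (∑-const {A = Point} (m * k * (m * k))) ⟩
      q * q * ∑ (λ c → hits c * hits c) + q * q * (m * k * (m * k))
        ∎
      where open ℕ.≤-Reasoning

    2k<q⇒|A|m<2q² : 2 * k < q → count A * m < 2 * (q * q)
    2k<q⇒|A|m<2q² 2k<q = a*m<2q² {m = m} {n = n} q≡k+d k<d
      (second-moment-bound {m = m} {n = n} q≡k+d ∑-hits ∑-hits² (∑-chebyshev d q≡k+d)) |A|≤2n
      where
      d : ℕ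
      d = q ∸ k
      q≡k+d : q ≡ k + d
      q≡k+d = sym (ℕ.m+[n∸m]≡n (ℕ.≤-trans (ℕ.m≤m+n k (k + 0)) (ℕ.<⇒≤ 2k<q)))
      k<d : k < d
      k<d = ℕ.m+n≤o⇒m≤o∸n (suc k) (subst (λ t → suc t ≤ q) (cong (k +_) (ℕ.+-identityʳ k)) 2k<q)

    distance-bound : 2 * q ^ 2 ≤ card² A * card² B → q ≤ 2 * cardΔ A B
    distance-bound large rewrite cardΔ≡count A B with q ℕ.≤? 2 * k
    ... | yes q≤2k = q≤2k
    ... | no  q≰2k = ⊥-elim (ℕ.<⇒≱ (2k<q⇒|A|m<2q² (ℕ.≰⇒> q≰2k)) (begin
      2 * (q * q)              ≡⟨ cong (λ t → 2 * (q * t)) (ℕ.*-identityʳ q) ⟨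
      2 * q ^ 2                ≤⟨ large ⟩
      card² A * card² B        ≡⟨ cong₂ _*_ (card²≡count A) (trans (card²≡count B) (count-onLine B⊆L)) ⟩
      count A * m              ∎))
      where open ℕ.≤-Reasoning

corollary1p8 : (q : ℕ) → OddPrimePower q → (F : FiniteField q) →
    let open FiniteField F in
    (a b λ' : Carrier) → λ' ≢ 0# →
    (1# + λ' · λ') ≢ 0# → IsSquare (1# + λ' · λ') →
    (A B : Subset²) →
    (∀ p → p ∈ᵇ B → p ∈L[ λ' , a , b ]) →
    2 * q ^ 2 ≤ card² A * card² B →
    q ≤ 2 * cardΔ A B
corollary1p8 q odd F a b λ' _ μ≢0 _ A B B⊆L =
  LineDistances.distance-bound F a b λ'
    (FiniteFieldProperties.odd⇒2≢0 F {q / 2} (oddPrimePower⇒odd odd)) μ≢0 A B B⊆L
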